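{- Let $(\Omega,S)$ be a regular thin Jordan scheme, fix $\omega_0\in\Omega$, let $\diamond$ and $\ell_a$ be as in the context, let $u,v\in S$, $A:=A_{u,v}=\{w\in S:u\diamond(v\diamond w)=(u\diamond v)\diamond w\}$ and $\bar A:=S\setminus A$. Then: (a) for every $w\in A$, $(u\diamond v)\diamond w=u\diamond(v\diamond w)$, and for every $w\in\bar A$, $(u\diamond v)\diamond w=v\diamond(u\diamond w)$; in particular, as relations, $\ell_{u\diamond v}\subseteq(\ell_u\circ\ell_v)\cup(\ell_v\circ\ell_u)$; (b) the set $A$ is invariant under $\ell_u$ and under $\ell_v$.
   Context: $\Omega$ is a finite nonempty set, $\mathbb{F}$ a field with $\mathrm{char}\,\mathbb{F}\neq2$, $A\star B=\tfrac12(AB+BA)$. A regular thin Jordan scheme $(\Omega,S)$ here means: $S$ is a set of permutations of $\Omega$, each regarded as the relation $\{(\omega,s(\omega))\}$, such that these relations partition $\Omega\times\Omega$, $1_\Omega\in S$, $s^{ -1}\in S$ for every $s\in S$, and the $\mathbb{F}$-span of the permutation matrices of the elements of $S$ is closed under $\star$. For fixed $\omega_0\in\Omega$ and $a,b\in S$, $a\diamond b$ is the unique $c\in S$ with $c(\omega_0)=a(b(\omega_0))$; $\ell_a:S\to S$ is $\ell_a(x)=a\diamond x$, regarded also as the relation $\{(x,\ell_a(x))\}$. -}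

module Defs where

open import Level using (Level; _⊔_) renaming (suc to lsuc)
open import Algebra.Bundles using (CommutativeRing)
open import Data.Nat.Base using (ℕ)
open import Data.Fin.Base using (Fin)
open import Data.Fin.Properties using (_≟_)
open import Data.Fin.Permutation using (Permutation′; _⟨$⟩ʳ_)
open import Data.Product.Base using (Σ; proj₁; _,_)
open import Data.Bool.Base using (if_then_else_)
open import Relation.Binary.PropositionalEquality.Core using (_≡_)
open import Relation.Nullary using (¬_)
open import Relation.Nullary.Decidable.Core using (⌊_⌋)

record Field c ℓ : Set (lsuc (c ⊔ ℓ)) where
  field
    commutativeRing : CommutativeRing c ℓ
  open CommutativeRing commutativeRing public
  field
    1≉0     : ¬ (1# ≈ 0#)
    inverse : ∀ x → ¬ (x ≈ 0#) → Σ Carrier (λ y → x * y ≈ 1#)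

CharNot2 : ∀ {c ℓ} → Field c ℓ → Set ℓ
CharNot2 F = ¬ (1# + 1# ≈ 0#)
  where open Field F

module Matrices {c ℓ} (F : Field c ℓ) (char : CharNot2 F) where
  open Field F
  open import Algebra.Definitions.RawMonoid +-rawMonoid using (sum)

  Mat : ℕ → Set c
  Mat n = Fin n → Fin n → Carrier

  ½ : Carrier
  ½ = proj₁ (inverse (1# + 1#) char)

  _·_ : ∀ {n} → Mat n → Mat n → Mat n
  (M · N) x y = sum (λ z → M x z * N z y)

  _⋆_ : ∀ {n} → Mat n → Mat n → Mat n
  (M ⋆ N) x y = ½ * ((M · N) x y + (N · M) x y)

  permMat : ∀ {n} → Permutation′ n → Mat n
  permMat s x y = if ⌊ (s ⟨$⟩ʳ x) ≟ y ⌋ then 1# else 0#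

  InSpan : ∀ {n k} → (Fin k → Permutation′ n) → Mat n → Set (c ⊔ ℓ)
  InSpan {n} {k} S M =
    Σ (Fin k → Carrier) (λ a → ∀ x y → M x y ≈ sum (λ i → a i * permMat (S i) x y))

-- A regular thin Jordan scheme on Ω = Fin n over F.
-- S is given as an indexed family S i (i : Fin k) of permutations of Ω,
-- each regarded as the relation {(ω , S i ω)}.
record RegularThinJordanScheme {c ℓ} (F : Field c ℓ) (char : CharNot2 F) (n : ℕ)
       : Set (c ⊔ ℓ) where
  open Field F
  open Matrices F char
  field
    k : ℕ
    S : Fin k → Permutation′ n
    partition        : ∀ x y → Σ (Fin k) (λ i → S i ⟨$⟩ʳ x ≡ y)
    partition-unique : ∀ x y i j → S i ⟨$⟩ʳ x ≡ y → S j ⟨$⟩ʳ x ≡ y → i ≡ j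
    identity : Σ (Fin k) (λ e → ∀ x → S e ⟨$⟩ʳ x ≡ x)
    inverses : ∀ i → Σ (Fin k) (λ j → ∀ x → S j ⟨$⟩ʳ (S i ⟨$⟩ʳ x) ≡ x)
    jordan-closed : ∀ M N → InSpan S M → InSpan S N → InSpan S (M ⋆ N)

module Diamond {c ℓ} {F : Field c ℓ} {char : CharNot2 F} {n : ℕ}
               (Sch : RegularThinJordanScheme F char n) (ω₀ : Fin n) where
  open RegularThinJordanScheme Sch

  _◇_ : Fin k → Fin k → Fin k
  a ◇ b = proj₁ (partition ω₀ (S a ⟨$⟩ʳ (S b ⟨$⟩ʳ ω₀)))

  ℓ[_] : Fin k → Fin k → Fin k
  ℓ[ a ] x = a ◇ x

  A[_,_] : Fin k → Fin k → Fin k → Set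
  A[ u , v ] w = u ◇ (v ◇ w) ≡ (u ◇ v) ◇ w

-- For s ∈ S let P_s be its permutation matrix. Then (P_a ⋆ P_b) x y is ½ times the
-- number of the composites a∘b, b∘a sending x to y, and since P_a ⋆ P_b lies in the
-- span of the thin family S, its entry at (x , (a ◇ b) x) is a coefficient, hence
-- independent of x. At ω₀ the composite a∘b agrees with a ◇ b, so (char F ≠ 2) at
-- every point a ◇ b agrees with a∘b or with b∘a, and if it agrees with both at one
-- point it does so everywhere. Both parts of the proposition are bookkeeping with
-- these two facts, translated from points of Ω to elements of S via s ↦ s(ω₀).
module Submission where

open import Defs
open import Algebra.Bundles using (Monoid)
open import Data.Nat.Base using (ℕ; suc)
open import Data.Bool.Base using (if_then_else_)
open import Data.Fin.Base using (Fin) renaming (zero to fzero; suc to fsuc)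
open import Data.Fin.Properties using (_≟_; suc-injective)
open import Data.Fin.Permutation using (Permutation′; _⟨$⟩ʳ_; _⟨$⟩ˡ_; inverseʳ)
open import Data.Product.Base using (_×_; _,_; proj₁; proj₂)
open import Data.Sum.Base using (_⊎_; inj₁; inj₂)
open import Data.Vec.Functional using (Vector)
open import Function.Base using (_∘_)
open import Relation.Binary.PropositionalEquality as ≡ using (_≡_; _≢_; cong)
open import Relation.Nullary using (¬_; Dec; yes; no; contradiction)
open import Relation.Nullary.Decidable.Core using (⌊_⌋)
import Algebra.Properties.Group
import Algebra.Properties.Monoid.Sum
import Relation.Binary.Reasoning.Setoid

module SingleTermSum {a ℓ} (M : Monoid a ℓ) where
  open Monoid M renaming (_∙_ to _+_; ε to 0#; identityˡ to +-identityˡ; identityʳ to +-identityʳ)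
  open Algebra.Properties.Monoid.Sum M using (sum; sum-cong-≋; sum-replicate-zero)

  sum-single : ∀ {m} (f : Vector Carrier m) j → (∀ i → i ≢ j → f i ≈ 0#) → sum f ≈ f j
  sum-single {suc m} f fzero f≈0 =
    trans (∙-cong refl (trans (sum-cong-≋ λ i → f≈0 (fsuc i) λ ()) (sum-replicate-zero m)))
          (+-identityʳ (f fzero))
  sum-single {suc m} f (fsuc j) f≈0 =
    trans (∙-cong (f≈0 fzero λ ())
                  (sum-single (f ∘ fsuc) j λ i i≢j → f≈0 (fsuc i) (i≢j ∘ suc-injective)))
          (+-identityˡ (f (fsuc j)))

module FieldFacts {c ℓ} (F : Field c ℓ) (char : CharNot2 F) where
  open Field F
  open Matrices F char using (½)
  open Algebra.Properties.Group +-group using (∙-cancelˡ; ∙-cancelʳ)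
  open Relation.Binary.Reasoning.Setoid setoid

  -- chosen so that permMat σ x y is definitionally 𝟙[ σ ⟨$⟩ʳ x ≟ y ]
  𝟙[_] : ∀ {p} {P : Set p} → Dec P → Carrier
  𝟙[ d ] = if ⌊ d ⌋ then 1# else 0#

  𝟙-yes : ∀ {p} {P : Set p} (d : Dec P) → P → 𝟙[ d ] ≈ 1#
  𝟙-yes (yes _) _  = refl
  𝟙-yes (no ¬p) p = contradiction p ¬p

  𝟙-no : ∀ {p} {P : Set p} (d : Dec P) → ¬ P → 𝟙[ d ] ≈ 0#
  𝟙-no (yes p) ¬p = contradiction p ¬p
  𝟙-no (no _)  _  = refl

  ½-cancel : ∀ {x y} → ½ * x ≈ ½ * y → x ≈ y
  ½-cancel {x} {y} ½x≈½y = begin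
    x                    ≈⟨ *-identityˡ x ⟨
    1# * x               ≈⟨ *-congʳ 2·½≈1 ⟨
    (1# + 1#) * ½ * x    ≈⟨ *-assoc _ ½ x ⟩
    (1# + 1#) * (½ * x)  ≈⟨ *-congˡ ½x≈½y ⟩
    (1# + 1#) * (½ * y)  ≈⟨ *-assoc _ ½ y ⟨
    (1# + 1#) * ½ * y    ≈⟨ *-congʳ 2·½≈1 ⟩
    1# * y               ≈⟨ *-identityˡ y ⟩
    y                    ∎
    where
    2·½≈1 : (1# + 1#) * ½ ≈ 1#
    2·½≈1 = proj₂ (inverse (1# + 1#) char)

  𝟙+1≉0 : ∀ {p} {P : Set p} (d : Dec P) → ¬ (𝟙[ d ] + 1# ≈ 0#)
  𝟙+1≉0 (yes _) = char
  𝟙+1≉0 (no _)  = 1≉0 ∘ trans (sym (+-identityˡ 1#))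

  𝟙+𝟙≉0 : ∀ {p q} {P : Set p} {Q : Set q} (d : Dec P) (e : Dec Q) →
          ¬ (𝟙[ d ] + 𝟙[ e ] ≈ 0#) → P ⊎ Q
  𝟙+𝟙≉0 (yes p) _       _ = inj₁ p
  𝟙+𝟙≉0 (no _)  (yes q) _ = inj₂ q
  𝟙+𝟙≉0 (no _)  (no _)  ≉0 = contradiction (+-identityˡ 0#) ≉0

  𝟙+𝟙≈2 : ∀ {p q} {P : Set p} {Q : Set q} (d : Dec P) (e : Dec Q) →
          𝟙[ d ] + 𝟙[ e ] ≈ 1# + 1# → P × Q
  𝟙+𝟙≈2 (yes p) (yes q) _ = p , q
  𝟙+𝟙≈2 (yes _) (no _)  ≈2 = contradiction (sym (∙-cancelˡ 1# 0# 1# ≈2)) 1≉0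
  𝟙+𝟙≈2 (no _)  (yes _) ≈2 = contradiction (sym (∙-cancelʳ 1# 0# 1# ≈2)) 1≉0
  𝟙+𝟙≈2 (no _)  (no _)  ≈2 = contradiction (trans (sym ≈2) (+-identityˡ 0#)) char

module PermutationMatrices {c ℓ} (F : Field c ℓ) (char : CharNot2 F) where
  open Field F
  open Matrices F char
  open FieldFacts F char
  open SingleTermSum +-monoid
  open Algebra.Properties.Monoid.Sum +-monoid using (sum)
  open Relation.Binary.Reasoning.Setoid setoid

  permMat-· : ∀ {n} (σ τ : Permutation′ n) x y → (permMat σ · permMat τ) x y ≈ permMat τ (σ ⟨$⟩ʳ x) y
  permMat-· σ τ x y = begin
    sum (λ z → permMat σ x z * permMat τ z y)   ≈⟨ sum-single _ (σ ⟨$⟩ʳ x) off-σx ⟩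
    permMat σ x (σ ⟨$⟩ʳ x) * permMat τ (σ ⟨$⟩ʳ x) y
                                                ≈⟨ *-congʳ (𝟙-yes (σ ⟨$⟩ʳ x ≟ σ ⟨$⟩ʳ x) ≡.refl) ⟩
    1# * permMat τ (σ ⟨$⟩ʳ x) y                 ≈⟨ *-identityˡ _ ⟩
    permMat τ (σ ⟨$⟩ʳ x) y                      ∎
    where
    off-σx : ∀ z → z ≢ σ ⟨$⟩ʳ x → permMat σ x z * permMat τ z y ≈ 0#
    off-σx z z≢σx = trans (*-congʳ (𝟙-no (σ ⟨$⟩ʳ x ≟ z) (z≢σx ∘ ≡.sym))) (zeroˡ _)

module Coefficients {c ℓ} {F : Field c ℓ} {char : CharNot2 F} {n : ℕ}
                    (Sch : RegularThinJordanScheme F char n) (ω₀ : Fin n) where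
  open Field F
  open Matrices F char
  open RegularThinJordanScheme Sch
  open Diamond Sch ω₀
  open FieldFacts F char
  open PermutationMatrices F char
  open SingleTermSum +-monoid
  open Algebra.Properties.Monoid.Sum +-monoid using (sum)
  open Relation.Binary.Reasoning.Setoid setoid

  ⟦_⟧ : Fin k → Fin n → Fin n
  ⟦ s ⟧ x = S s ⟨$⟩ʳ x

  Composite : Fin k → Fin k → Fin k → Fin n → Set
  Composite s a b x = ⟦ s ⟧ x ≡ ⟦ a ⟧ (⟦ b ⟧ x)

  S-injective-at : ∀ x {i j} → ⟦ i ⟧ x ≡ ⟦ j ⟧ x → i ≡ j
  S-injective-at x {i} {j} eq = partition-unique x (⟦ j ⟧ x) i j eq ≡.refl

  ◇-composite-at-ω₀ : ∀ a b → Composite (a ◇ b) a b ω₀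
  ◇-composite-at-ω₀ a b = proj₂ (partition ω₀ (⟦ a ⟧ (⟦ b ⟧ ω₀)))

  permMat-∈-span : ∀ a → InSpan S (permMat (S a))
  permMat-∈-span a = (λ i → 𝟙[ i ≟ a ]) , λ x y → sym (expand x y)
    where
    expand : ∀ x y → sum (λ i → 𝟙[ i ≟ a ] * permMat (S i) x y) ≈ permMat (S a) x y
    expand x y = begin
      sum (λ i → 𝟙[ i ≟ a ] * permMat (S i) x y)  ≈⟨ sum-single _ a off-a ⟩
      𝟙[ a ≟ a ] * permMat (S a) x y              ≈⟨ *-congʳ (𝟙-yes (a ≟ a) ≡.refl) ⟩
      1# * permMat (S a) x y                      ≈⟨ *-identityˡ _ ⟩
      permMat (S a) x y                           ∎
      where
      off-a : ∀ i → i ≢ a → 𝟙[ i ≟ a ] * permMat (S i) x y ≈ 0#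
      off-a i i≢a = trans (*-congʳ (𝟙-no (i ≟ a) i≢a)) (zeroˡ _)

  InSpan-coefficient : ∀ {M} ((α , M≈) : InSpan S M) x j → M x (⟦ j ⟧ x) ≈ α j
  InSpan-coefficient {M} (α , M≈) x j = begin
    M x (⟦ j ⟧ x)                                     ≈⟨ M≈ x (⟦ j ⟧ x) ⟩
    sum (λ i → α i * permMat (S i) x (⟦ j ⟧ x))       ≈⟨ sum-single _ j off-j ⟩
    α j * permMat (S j) x (⟦ j ⟧ x)                   ≈⟨ *-congˡ (𝟙-yes (⟦ j ⟧ x ≟ ⟦ j ⟧ x) ≡.refl) ⟩
    α j * 1#                                          ≈⟨ *-identityʳ (α j) ⟩
    α j                                               ∎
    where
    off-j : ∀ i → i ≢ j → α i * permMat (S i) x (⟦ j ⟧ x) ≈ 0#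
    off-j i i≢j = trans (*-congˡ (𝟙-no (⟦ i ⟧ x ≟ ⟦ j ⟧ x) (i≢j ∘ S-injective-at x))) (zeroʳ (α i))

  #agreeing : Fin k → Fin k → Fin n → Carrier
  #agreeing a b x = 𝟙[ ⟦ b ⟧ (⟦ a ⟧ x) ≟ ⟦ a ◇ b ⟧ x ] + 𝟙[ ⟦ a ⟧ (⟦ b ⟧ x) ≟ ⟦ a ◇ b ⟧ x ]

  #agreeing-constant : ∀ a b x y → #agreeing a b x ≈ #agreeing a b y
  #agreeing-constant a b x y = ½-cancel (trans (½#agreeing≈α x) (sym (½#agreeing≈α y)))
    where
    P⋆∈span : InSpan S (permMat (S a) ⋆ permMat (S b))
    P⋆∈span = jordan-closed _ _ (permMat-∈-span a) (permMat-∈-span b)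

    ½#agreeing≈α : ∀ z → ½ * #agreeing a b z ≈ proj₁ P⋆∈span (a ◇ b)
    ½#agreeing≈α z = begin
      ½ * #agreeing a b z                                 ≈⟨ *-congˡ (+-cong (permMat-· (S a) (S b) z _)
                                                                            (permMat-· (S b) (S a) z _)) ⟨
      (permMat (S a) ⋆ permMat (S b)) z (⟦ a ◇ b ⟧ z)     ≈⟨ InSpan-coefficient P⋆∈span z (a ◇ b) ⟩
      proj₁ P⋆∈span (a ◇ b)                               ∎

  ◇-composite : ∀ a b x → Composite (a ◇ b) a b x ⊎ Composite (a ◇ b) b a x
  ◇-composite a b x with 𝟙+𝟙≉0 (⟦ b ⟧ (⟦ a ⟧ x) ≟ ⟦ a ◇ b ⟧ x) (⟦ a ⟧ (⟦ b ⟧ x) ≟ ⟦ a ◇ b ⟧ x) #agreeing≉0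
    where
    #agreeing≉0 : ¬ (#agreeing a b x ≈ 0#)
    #agreeing≉0 ≈0 = 𝟙+1≉0 (⟦ b ⟧ (⟦ a ⟧ ω₀) ≟ ⟦ a ◇ b ⟧ ω₀) (begin
      𝟙[ ⟦ b ⟧ (⟦ a ⟧ ω₀) ≟ ⟦ a ◇ b ⟧ ω₀ ] + 1#
                          ≈⟨ +-congˡ (𝟙-yes (⟦ a ⟧ (⟦ b ⟧ ω₀) ≟ ⟦ a ◇ b ⟧ ω₀) (≡.sym (◇-composite-at-ω₀ a b))) ⟨
      #agreeing a b ω₀    ≈⟨ #agreeing-constant a b ω₀ x ⟩
      #agreeing a b x     ≈⟨ ≈0 ⟩
      0#                  ∎)
  ... | inj₁ ba = inj₂ (≡.sym ba)
  ... | inj₂ ab = inj₁ (≡.sym ab)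

  ◇-bicomposite-everywhere : ∀ a b x → Composite (a ◇ b) a b x → Composite (a ◇ b) b a x →
                             ∀ z → Composite (a ◇ b) a b z × Composite (a ◇ b) b a z
  ◇-bicomposite-everywhere a b x ab ba z
    with 𝟙+𝟙≈2 (⟦ b ⟧ (⟦ a ⟧ z) ≟ ⟦ a ◇ b ⟧ z) (⟦ a ⟧ (⟦ b ⟧ z) ≟ ⟦ a ◇ b ⟧ z) (begin
      #agreeing a b z     ≈⟨ #agreeing-constant a b z x ⟩
      #agreeing a b x     ≈⟨ +-cong (𝟙-yes (⟦ b ⟧ (⟦ a ⟧ x) ≟ _) (≡.sym ba))
                                    (𝟙-yes (⟦ a ⟧ (⟦ b ⟧ x) ≟ _) (≡.sym ab)) ⟩
      1# + 1#             ∎)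
  ... | ba′ , ab′ = ≡.sym ab′ , ≡.sym ba′

module Reassociation {c ℓ} {F : Field c ℓ} {char : CharNot2 F} {n : ℕ}
                     (Sch : RegularThinJordanScheme F char n) (ω₀ : Fin n) where
  open RegularThinJordanScheme Sch
  open Diamond Sch ω₀
  open Coefficients Sch ω₀
  open ≡.≡-Reasoning

  infix 30 _⁻¹
  _⁻¹ : Fin k → Fin k
  a ⁻¹ = proj₁ (inverses a)

  ⁻¹-inverseˡ : ∀ a x → ⟦ a ⁻¹ ⟧ (⟦ a ⟧ x) ≡ x
  ⁻¹-inverseˡ a = proj₂ (inverses a)

  ⁻¹-inverseʳ : ∀ a x → ⟦ a ⟧ (⟦ a ⁻¹ ⟧ x) ≡ x
  ⁻¹-inverseʳ a x = begin
    ⟦ a ⟧ (⟦ a ⁻¹ ⟧ x)                          ≡⟨ cong (⟦ a ⟧ ∘ ⟦ a ⁻¹ ⟧) (inverseʳ (S a)) ⟨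
    ⟦ a ⟧ (⟦ a ⁻¹ ⟧ (⟦ a ⟧ (S a ⟨$⟩ˡ x)))        ≡⟨ cong ⟦ a ⟧ (⁻¹-inverseˡ a _) ⟩
    ⟦ a ⟧ (S a ⟨$⟩ˡ x)                          ≡⟨ inverseʳ (S a) ⟩
    x                                           ∎

  ⁻¹-◇-cancel : ∀ a b → a ⁻¹ ◇ (a ◇ b) ≡ b
  ⁻¹-◇-cancel a b = S-injective-at ω₀ (begin
    ⟦ a ⁻¹ ◇ (a ◇ b) ⟧ ω₀             ≡⟨ ◇-composite-at-ω₀ (a ⁻¹) (a ◇ b) ⟩
    ⟦ a ⁻¹ ⟧ (⟦ a ◇ b ⟧ ω₀)           ≡⟨ cong ⟦ a ⁻¹ ⟧ (◇-composite-at-ω₀ a b) ⟩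
    ⟦ a ⁻¹ ⟧ (⟦ a ⟧ (⟦ b ⟧ ω₀))       ≡⟨ ⁻¹-inverseˡ a _ ⟩
    ⟦ b ⟧ ω₀                          ∎)

  -- Otherwise b ◇ a = a ◇ b, which then agrees with both composites at ω₀.
  composite-swap : ∀ a b y → Composite (a ◇ b) a b y → Composite (b ◇ a) b a y
  composite-swap a b y ab with ◇-composite b a y
  ... | inj₁ ba = ba
  ... | inj₂ ab′ = begin
    ⟦ b ◇ a ⟧ y       ≡⟨ cong (λ s → ⟦ s ⟧ y) b◇a≡a◇b ⟩
    ⟦ a ◇ b ⟧ y       ≡⟨ proj₂ (◇-bicomposite-everywhere a b ω₀ (◇-composite-at-ω₀ a b) ba₀ y) ⟩
    ⟦ b ⟧ (⟦ a ⟧ y)   ∎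
    where
    b◇a≡a◇b : b ◇ a ≡ a ◇ b
    b◇a≡a◇b = S-injective-at y (≡.trans ab′ (≡.sym ab))

    ba₀ : Composite (a ◇ b) b a ω₀
    ba₀ = ≡.trans (cong (λ s → ⟦ s ⟧ ω₀) (≡.sym b◇a≡a◇b)) (◇-composite-at-ω₀ b a)

  -- Apply the dichotomy to a ⁻¹ and a ◇ b at a y, using a ⁻¹ ◇ (a ◇ b) = b: one branch
  -- is the claim, the other makes a ◇ b agree with both composites at y.
  composite-shift : ∀ a b y → Composite (a ◇ b) a b y → Composite (a ◇ b) a b (⟦ a ⟧ y)
  composite-shift a b y ab with ◇-composite (a ⁻¹) (a ◇ b) (⟦ a ⟧ y)
  ... | inj₁ a⁻¹c = begin
    ⟦ a ◇ b ⟧ (⟦ a ⟧ y)                        ≡⟨ ⁻¹-inverseʳ a _ ⟨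
    ⟦ a ⟧ (⟦ a ⁻¹ ⟧ (⟦ a ◇ b ⟧ (⟦ a ⟧ y)))     ≡⟨ cong ⟦ a ⟧ a⁻¹c ⟨
    ⟦ a ⟧ (⟦ a ⁻¹ ◇ (a ◇ b) ⟧ (⟦ a ⟧ y))       ≡⟨ cong (λ s → ⟦ a ⟧ (⟦ s ⟧ (⟦ a ⟧ y))) (⁻¹-◇-cancel a b) ⟩
    ⟦ a ⟧ (⟦ b ⟧ (⟦ a ⟧ y))                    ∎
  ... | inj₂ ca⁻¹ = proj₁ (◇-bicomposite-everywhere a b y ab ba (⟦ a ⟧ y))
    where
    ba : Composite (a ◇ b) b a y
    ba = ≡.sym (begin
      ⟦ b ⟧ (⟦ a ⟧ y)                        ≡⟨ cong (λ s → ⟦ s ⟧ (⟦ a ⟧ y)) (⁻¹-◇-cancel a b) ⟨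
      ⟦ a ⁻¹ ◇ (a ◇ b) ⟧ (⟦ a ⟧ y)           ≡⟨ ca⁻¹ ⟩
      ⟦ a ◇ b ⟧ (⟦ a ⁻¹ ⟧ (⟦ a ⟧ y))         ≡⟨ cong ⟦ a ◇ b ⟧ (⁻¹-inverseˡ a y) ⟩
      ⟦ a ◇ b ⟧ y                            ∎)

  ◇◇-at-ω₀ : ∀ a b w → ⟦ a ◇ (b ◇ w) ⟧ ω₀ ≡ ⟦ a ⟧ (⟦ b ⟧ (⟦ w ⟧ ω₀))
  ◇◇-at-ω₀ a b w = ≡.trans (◇-composite-at-ω₀ a (b ◇ w)) (cong ⟦ a ⟧ (◇-composite-at-ω₀ b w))

  A⇒composite : ∀ {a b w} → A[ a , b ] w → Composite (a ◇ b) a b (⟦ w ⟧ ω₀)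
  A⇒composite {a} {b} {w} assoc = begin
    ⟦ a ◇ b ⟧ (⟦ w ⟧ ω₀)         ≡⟨ ◇-composite-at-ω₀ (a ◇ b) w ⟨
    ⟦ (a ◇ b) ◇ w ⟧ ω₀           ≡⟨ cong (λ s → ⟦ s ⟧ ω₀) assoc ⟨
    ⟦ a ◇ (b ◇ w) ⟧ ω₀           ≡⟨ ◇◇-at-ω₀ a b w ⟩
    ⟦ a ⟧ (⟦ b ⟧ (⟦ w ⟧ ω₀))     ∎

  composite⇒A : ∀ {a b w} → Composite (a ◇ b) a b (⟦ w ⟧ ω₀) → A[ a , b ] w
  composite⇒A {a} {b} {w} ab = S-injective-at ω₀ (begin
    ⟦ a ◇ (b ◇ w) ⟧ ω₀           ≡⟨ ◇◇-at-ω₀ a b w ⟩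
    ⟦ a ⟧ (⟦ b ⟧ (⟦ w ⟧ ω₀))     ≡⟨ ab ⟨
    ⟦ a ◇ b ⟧ (⟦ w ⟧ ω₀)         ≡⟨ ◇-composite-at-ω₀ (a ◇ b) w ⟨
    ⟦ (a ◇ b) ◇ w ⟧ ω₀           ∎)

  ◇-reverse-outside-A : ∀ a b w → ¬ A[ a , b ] w → (a ◇ b) ◇ w ≡ b ◇ (a ◇ w)
  ◇-reverse-outside-A a b w ¬assoc with ◇-composite a b (⟦ w ⟧ ω₀)
  ... | inj₁ ab = contradiction (composite⇒A ab) ¬assoc
  ... | inj₂ ba = S-injective-at ω₀ (begin
    ⟦ (a ◇ b) ◇ w ⟧ ω₀           ≡⟨ ◇-composite-at-ω₀ (a ◇ b) w ⟩
    ⟦ a ◇ b ⟧ (⟦ w ⟧ ω₀)         ≡⟨ ba ⟩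
    ⟦ b ⟧ (⟦ a ⟧ (⟦ w ⟧ ω₀))     ≡⟨ ◇◇-at-ω₀ b a w ⟨
    ⟦ b ◇ (a ◇ w) ⟧ ω₀           ∎)

  ℓ-◇-⊆-∘∪∘ : ∀ a b x y → ℓ[ a ◇ b ] x ≡ y → ℓ[ a ] (ℓ[ b ] x) ≡ y ⊎ ℓ[ b ] (ℓ[ a ] x) ≡ y
  ℓ-◇-⊆-∘∪∘ a b x y ab≡y with a ◇ (b ◇ x) ≟ (a ◇ b) ◇ x
  ... | yes assoc  = inj₁ (≡.trans assoc ab≡y)
  ... | no ¬assoc = inj₂ (≡.trans (≡.sym (◇-reverse-outside-A a b x ¬assoc)) ab≡y)

  A-ℓˡ-invariant : ∀ a b w → A[ a , b ] w → A[ a , b ] (ℓ[ a ] w)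
  A-ℓˡ-invariant a b w assoc = composite⇒A
    (≡.subst (Composite (a ◇ b) a b) (≡.sym (◇-composite-at-ω₀ a w))
      (composite-shift a b _ (A⇒composite assoc)))

  A-ℓʳ-invariant : ∀ a b w → A[ a , b ] w → A[ a , b ] (ℓ[ b ] w)
  A-ℓʳ-invariant a b w assoc = composite⇒A
    (≡.subst (Composite (a ◇ b) a b) (≡.sym (◇-composite-at-ω₀ b w))
      (composite-swap b a _ (composite-shift b a _ (composite-swap a b _ (A⇒composite assoc)))))

proposition3p10 : ∀ {c ℓ} (F : Field c ℓ) (char : CharNot2 F) (n : ℕ)
    (Sch : RegularThinJordanScheme F char n) (ω₀ : Fin n)
    (u v : Fin (RegularThinJordanScheme.k Sch)) →
    let open Diamond Sch ω₀ in
    (∀ w → A[ u , v ] w → (u ◇ v) ◇ w ≡ u ◇ (v ◇ w))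
    × (∀ w → ¬ A[ u , v ] w → (u ◇ v) ◇ w ≡ v ◇ (u ◇ w))
    × (∀ x y → ℓ[ u ◇ v ] x ≡ y → (ℓ[ u ] (ℓ[ v ] x) ≡ y ⊎ ℓ[ v ] (ℓ[ u ] x) ≡ y))
    × (∀ w → A[ u , v ] w → A[ u , v ] (ℓ[ u ] w))
    × (∀ w → A[ u , v ] w → A[ u , v ] (ℓ[ v ] w))
proposition3p10 F char n Sch ω₀ u v =
  (λ _ → ≡.sym) , ◇-reverse-outside-A u v , ℓ-◇-⊆-∘∪∘ u v , A-ℓˡ-invariant u v , A-ℓʳ-invariant u v
  where open Reassociation Sch ω₀
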